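{- Let $(G,(A,B,S))$ be a structured pair satisfying (NE1) and (NE2). Then for every two distinct nonadjacent vertices $x,y\in S$ we have $N_A(x)=N_A(y)$ if and only if $N_B(x)=N_B(y)$.
   Context: All graphs are finite and simple. $N(X)$ is the set of vertices outside $X$ with a neighbour in $X$, $N_Y(X)=N(X)\cap Y$, $N_Y(x)=N_Y(\{x\})$, $N_Y(x,y)=N_Y(\{x,y\})$, $N_S[v]=(N(v)\cup\{v\})\cap S$. A structured pair is $(G,(A,B,S))$ with $A,B,S$ nonempty partitioning $V(G)$, $G[A]$ and $G[B]$ connected, $N(A)=N(B)=S$, and for some $\varepsilon>0$, $|N_S[v]|\leq\varepsilon|S|$ for all $v$. (NE1): for every $x\in S$, $A\not\subseteq N(x)$ and $B\not\subseteq N(x)$. (NE2): for all distinct nonadjacent $x,y\in S$, if $N_B(x)\neq N_B(y)$ then there is no edge between $N_A(x)\cap N_A(y)$ and $A\setminus N_A(x,y)$, and the same with $A$ and $B$ swapped. -}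

module Defs where

open import Data.Nat using (ℕ; suc; _*_; _≤_; _<_)
open import Data.Bool using (Bool; true; false; _∧_)
open import Data.Fin using (Fin)
open import Data.Fin.Subset using (Subset; _∈_; _∉_; ∣_∣)
open import Data.Vec using (tabulate)
open import Data.Product using (Σ; ∃; ∃-syntax; _×_)
open import Data.Empty using (⊥)
open import Relation.Nullary using (¬_)
open import Relation.Binary.PropositionalEquality using (_≡_; _≢_)
open import Function.Bundles using (_⇔_)
import Data.Sum
import Data.Vec
import Relation.Nullary.Decidable
import Data.Fin

record Graph (n : ℕ) : Set where
  field
    adj     : Fin n → Fin n → Bool
    sym     : ∀ u v → adj u v ≡ adj v u
    irrefl  : ∀ v → adj v v ≡ false

module _ {n : ℕ} (G : Graph n) where
  open Graph G

  Adj : Fin n → Fin n → Set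
  Adj u v = adj u v ≡ true

  data WalkIn (X : Subset n) : Fin n → Fin n → Set where
    here : ∀ {u} → u ∈ X → WalkIn X u u
    step : ∀ {u v w} → u ∈ X → Adj u v → WalkIn X v w → WalkIn X u w

  -- G[X] connected (X is nonempty in our use)
  Connected : Subset n → Set
  Connected X = ∀ u v → u ∈ X → v ∈ X → WalkIn X u v

  InNbhd : Subset n → Fin n → Set
  InNbhd X v = v ∉ X × ∃[ u ] (u ∈ X × Adj v u)

  closedNbhdIn : Subset n → Fin n → Subset n
  closedNbhdIn S v = tabulate λ u → (Data.Bool._∨_ (adj v u) (isEq u)) ∧ Data.Vec.lookup S u
    where
      isEq : Fin n → Bool
      isEq u = Relation.Nullary.Decidable.⌊ Data.Fin._≟_ v u ⌋

  NIn : Subset n → Fin n → Fin n → Set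
  NIn X x u = u ∈ X × Adj x u

  SameNbhdIn : Subset n → Fin n → Fin n → Set
  SameNbhdIn X x y = ∀ u → NIn X x u ⇔ NIn X y u

  record StructuredPair (A B S : Subset n) : Set where
    field
      A-nonempty : ∃[ v ] v ∈ A
      B-nonempty : ∃[ v ] v ∈ B
      S-nonempty : ∃[ v ] v ∈ S
      cover      : ∀ v → v ∈ A Data.Sum.⊎ (v ∈ B Data.Sum.⊎ v ∈ S)
      disjAB     : ∀ v → v ∈ A → v ∈ B → ⊥
      disjAS     : ∀ v → v ∈ A → v ∈ S → ⊥
      disjBS     : ∀ v → v ∈ B → v ∈ S → ⊥
      A-conn     : Connected A
      B-conn     : Connected B
      NA≡S       : ∀ v → InNbhd A v ⇔ (v ∈ S)
      NB≡S       : ∀ v → InNbhd B v ⇔ (v ∈ S)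
      -- ∃ ε > 0 with |N_S[v]| ≤ ε|S|, ε = p/q rational with p,q > 0
      eps        : ∃[ p ] ∃[ q ] (0 < p × 0 < q ×
                     (∀ v → q * ∣ closedNbhdIn S v ∣ ≤ p * ∣ S ∣))

  NE1 : Subset n → Subset n → Subset n → Set
  NE1 A B S = ∀ x → x ∈ S →
    ¬ (∀ a → a ∈ A → Adj x a) × ¬ (∀ b → b ∈ B → Adj x b)

  NoEdgeCommonRest : Subset n → Fin n → Fin n → Set
  NoEdgeCommonRest X x y =
    ∀ u v → NIn X x u → NIn X y u →
      v ∈ X → ¬ Adj x v → ¬ Adj y v → ¬ Adj u v

  NE2 : Subset n → Subset n → Subset n → Set
  NE2 A B S = ∀ x y → x ∈ S → y ∈ S → x ≢ y → ¬ Adj x y →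
    (¬ SameNbhdIn B x y → NoEdgeCommonRest A x y) ×
    (¬ SameNbhdIn A x y → NoEdgeCommonRest B x y)

-- If N_A(x) = N_A(y) but N_B(x) ≠ N_B(y), then (NE2) says no edge of G[A] leaves
-- N_A(x) = N_A(x) ∩ N_A(y) towards A ∖ N_A(x,y) = A ∖ N_A(x).  As x ∈ S = N(A) has a
-- neighbour in A and G[A] is connected, N_A(x) is then all of A, contradicting (NE1).
-- Symmetrically with A and B swapped; equality of finite neighbourhoods is decidable,
-- so the two contradictions give the two implications.
module Submission where

open import Defs
open import Data.Nat using (ℕ)
open import Data.Fin using (Fin)
open import Data.Fin.Subset using (Subset; _∈_)
open import Data.Fin.Subset.Properties using (_∈?_)
open import Data.Bool using (true)
open import Data.Bool.Properties using (_≟_)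
open import Data.Product using (_,_; proj₁; proj₂; ∃-syntax)
open import Relation.Nullary using (¬_; Dec; yes; no; contradiction)
open import Relation.Nullary.Decidable using (map′; _×-dec_; _→-dec_; decidable-stable)
open import Relation.Binary.PropositionalEquality using (_≢_)
open import Function.Bundles using (_⇔_; mk⇔; Equivalence)

_⇔-dec_ : ∀ {a b} {P : Set a} {Q : Set b} → Dec P → Dec Q → Dec (P ⇔ Q)
p? ⇔-dec q? = map′ (λ (to , from) → mk⇔ to from) (λ e → Equivalence.to e , Equivalence.from e)
  ((p? →-dec q?) ×-dec (q? →-dec p?))

module _ {n : ℕ} (G : Graph n) where

  adj? : ∀ u v → Dec (Adj G u v)
  adj? u v = Graph.adj G u v ≟ true

  WalkIn-head∈ : ∀ {X u v} → WalkIn G X u v → u ∈ X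
  WalkIn-head∈ (here u∈X)     = u∈X
  WalkIn-head∈ (step u∈X _ _) = u∈X

  WalkIn-transport : ∀ {p} {X : Subset n} (P : Fin n → Set p) →
    (∀ {u v} → u ∈ X → P u → v ∈ X → Adj G u v → P v) →
    ∀ {a b} → WalkIn G X a b → P a → P b
  WalkIn-transport P closed (here _)            Pa = Pa
  WalkIn-transport P closed (step a∈X av walk)  Pa =
    WalkIn-transport P closed walk (closed a∈X Pa (WalkIn-head∈ walk) av)

  NbhdIsolatedIn : Subset n → Fin n → Set
  NbhdIsolatedIn X x = ∀ u v → NIn G X x u → v ∈ X → ¬ Adj G x v → ¬ Adj G u v

  NbhdIsolatedIn⇒dominates : ∀ {X x} → Connected G X → ∃[ a₀ ] NIn G X x a₀ →
    NbhdIsolatedIn X x → ∀ a → a ∈ X → Adj G x a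
  NbhdIsolatedIn⇒dominates {X} {x} conn (a₀ , a₀∈X , xa₀) isolated a a∈X =
    WalkIn-transport (Adj G x) closed (conn a₀ a a₀∈X a∈X) xa₀
    where
      closed : ∀ {u v} → u ∈ X → Adj G x u → v ∈ X → Adj G u v → Adj G x v
      closed {u} {v} u∈X xu v∈X uv with adj? x v
      ... | yes xv = xv
      ... | no ¬xv = contradiction uv (isolated u v (u∈X , xu) v∈X ¬xv)

  SameNbhdIn⇒NbhdIsolatedIn : ∀ {X x y} → SameNbhdIn G X x y →
    NoEdgeCommonRest G X x y → NbhdIsolatedIn X x
  SameNbhdIn⇒NbhdIsolatedIn {X} {x} {y} same noEdge u v x∼u v∈X ¬xv =
    noEdge u v x∼u (Equivalence.to (same u) x∼u) v∈X ¬xv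
      (λ yv → ¬xv (proj₂ (Equivalence.from (same v) (v∈X , yv))))

  SameNbhdIn⇒¬NoEdgeCommonRest : ∀ {X x y} → Connected G X → ∃[ a₀ ] NIn G X x a₀ →
    ¬ (∀ a → a ∈ X → Adj G x a) → SameNbhdIn G X x y → ¬ NoEdgeCommonRest G X x y
  SameNbhdIn⇒¬NoEdgeCommonRest conn x∼a₀ ¬dominates same noEdge =
    ¬dominates (NbhdIsolatedIn⇒dominates conn x∼a₀ (SameNbhdIn⇒NbhdIsolatedIn same noEdge))

  NIn? : ∀ X x u → Dec (NIn G X x u)
  NIn? X x u = (u ∈? X) ×-dec adj? x u

  SameNbhdIn-stable : ∀ X x y → ¬ ¬ SameNbhdIn G X x y → SameNbhdIn G X x y
  SameNbhdIn-stable X x y ¬¬same u =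
    decidable-stable (NIn? X x u ⇔-dec NIn? X y u) (λ ¬same-u → ¬¬same (λ same → ¬same-u (same u)))

lemma5p2 : ∀ {n} (G : Graph n) (A B S : Subset n) →
    StructuredPair G A B S → NE1 G A B S → NE2 G A B S →
    ∀ x y → x ∈ S → y ∈ S → x ≢ y → ¬ Adj G x y →
    SameNbhdIn G A x y ⇔ SameNbhdIn G B x y
lemma5p2 G A B S sp ne1 ne2 x y x∈S y∈S x≢y ¬xy = mk⇔
  (λ sameA → SameNbhdIn-stable G B x y λ ¬sameB →
     SameNbhdIn⇒¬NoEdgeCommonRest G A-conn x∼A ¬x⊸A sameA (noEdgeA ¬sameB))
  (λ sameB → SameNbhdIn-stable G A x y λ ¬sameA →
     SameNbhdIn⇒¬NoEdgeCommonRest G B-conn x∼B ¬x⊸B sameB (noEdgeB ¬sameA))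
  where
    open StructuredPair sp

    x∼A : ∃[ a ] NIn G A x a
    x∼A = proj₂ (Equivalence.from (NA≡S x) x∈S)

    x∼B : ∃[ b ] NIn G B x b
    x∼B = proj₂ (Equivalence.from (NB≡S x) x∈S)

    ¬x⊸A : ¬ (∀ a → a ∈ A → Adj G x a)
    ¬x⊸A = proj₁ (ne1 x x∈S)

    ¬x⊸B : ¬ (∀ b → b ∈ B → Adj G x b)
    ¬x⊸B = proj₂ (ne1 x x∈S)

    noEdgeA : ¬ SameNbhdIn G B x y → NoEdgeCommonRest G A x y
    noEdgeA = proj₁ (ne2 x y x∈S y∈S x≢y ¬xy)

    noEdgeB : ¬ SameNbhdIn G A x y → NoEdgeCommonRest G B x y
    noEdgeB = proj₂ (ne2 x y x∈S y∈S x≢y ¬xy)
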